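{- Let $\varphi_1:\{0,1\}^{m_1}\to\mathcal{B}(n_1,w_1)$ be an $(m_1,n_1,w_1)$-domination mapping and $\varphi_2:\{0,1\}^{m_2}\to\mathcal{B}(n_2,w_2)$ be an $(m_2,n_2,w_2)$-domination mapping. Define $\varphi:\{0,1\}^{m_1+m_2}\to\{0,1\}^{n_1+n_2}$ by $\varphi(x_1,x_2)=(\varphi_1(x_1),\varphi_2(x_2))$ for $x_1\in\{0,1\}^{m_1}$, $x_2\in\{0,1\}^{m_2}$, where $(\cdot,\cdot)$ denotes concatenation. Then $\varphi$ is an $(m_1+m_2,n_1+n_2,w_1+w_2)$-domination mapping.
   Context: For $y \in \{0,1\}^n$, $\mathrm{wt}(y)$ is the number of nonzero coordinates, and $\mathcal{B}(n,w)=\{y\in\{0,1\}^n : \mathrm{wt}(y)\le w\}$. A domination graph is a bipartite graph $G=([m]\cup[n],E)$ with left vertex set $[m]$ and right vertex set $[n]$ having no isolated right vertices. An injective map $\varphi:\{0,1\}^m\to\mathcal{B}(n,w)$ is $G$-dominating if for every $x\in\{0,1\}^m$ and every edge $(i,j)\in E$: $x_i=0$ implies that the $j$-th coordinate of $\varphi(x)$ is $0$. An $(m,n,w)$-domination mapping is an injective map $\{0,1\}^m\to\mathcal{B}(n,w)$ that is $G$-dominating for some domination graph $G=([m]\cup[n],E)$. -}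

module Defs where

open import Data.Nat using (ℕ; zero; suc; _≤_; _+_)
open import Data.Bool using (Bool; true; false; T)
open import Data.Fin using (Fin)
open import Data.Vec using (Vec; []; _∷_; lookup; _++_; take; drop)
open import Data.Product using (Σ; ∃; ∃-syntax; _×_)
open import Relation.Binary.PropositionalEquality using (_≡_)
open import Function.Definitions using (Injective)

-- Binary words {0,1}^n as Bool vectors (true = 1).
-- Hamming weight: number of nonzero coordinates.
wt : ∀ {n} → Vec Bool n → ℕ
wt [] = zero
wt (true ∷ y) = suc (wt y)
wt (false ∷ y) = wt y

InBall : ∀ {n} → ℕ → Vec Bool n → Set
InBall w y = wt y ≤ w

record DominationGraph (m n : ℕ) : Set₁ where
  field
    Edge : Fin m → Fin n → Set
    noIsolatedRight : (j : Fin n) → ∃[ i ] Edge i j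

IsDominating : ∀ {m n} → DominationGraph m n → (Vec Bool m → Vec Bool n) → Set
IsDominating {m} {n} G φ =
  (x : Vec Bool m) (i : Fin m) (j : Fin n) →
  DominationGraph.Edge G i j → lookup x i ≡ false → lookup (φ x) j ≡ false

IsDominationMapping : (m n w : ℕ) → (Vec Bool m → Vec Bool n) → Set₁
IsDominationMapping m n w φ =
  ((x : Vec Bool m) → InBall w (φ x)) ×
  Injective _≡_ _≡_ φ ×
  Σ (DominationGraph m n) (λ G → IsDominating G φ)

concatMap : ∀ {m₁ m₂ n₁ n₂} →
  (Vec Bool m₁ → Vec Bool n₁) → (Vec Bool m₂ → Vec Bool n₂) →
  Vec Bool (m₁ + m₂) → Vec Bool (n₁ + n₂)
concatMap {m₁} {m₂} φ₁ φ₂ x = φ₁ (take m₁ x) ++ φ₂ (drop m₁ x)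

-- The three defining properties are
-- established separately, each for arbitrary maps of the right shape:
--   * weight:      wt is additive under ++, so the weight bounds add up;
--   * injectivity: ++ is injective on blocks of fixed length and every word of
--                  length m₁+m₂ is the concatenation of its take and drop;
--   * domination:  the disjoint union G₁ ⊕ G₂ of the two domination graphs
--                  (edges only inside each block) is again a domination graph,
--                  and φ is (G₁ ⊕ G₂)-dominating because, read through splitAt,
--                  every edge and every coordinate lives in one of the blocks.
module Submission where

open import Defs
open import Data.Nat using (ℕ; _+_; suc)
open import Data.Nat.Properties using (+-mono-≤)
open import Data.Bool using (Bool; true; false)
open import Data.Vec using (Vec; []; _∷_; lookup; _++_; take; drop)
open import Data.Vec.Properties using (take++drop≡id; ++-injective; lookup-splitAt)
open import Data.Fin using (Fin; splitAt; _↑ˡ_; _↑ʳ_)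
open import Data.Fin.Properties using (splitAt-↑ˡ; splitAt-↑ʳ)
open import Data.Sum using (_⊎_; inj₁; inj₂; [_,_]′)
open import Data.Product using (∃-syntax; _,_)
open import Data.Empty using (⊥)
open import Function.Definitions using (Injective)
open import Relation.Binary.PropositionalEquality

wt-++ : ∀ {a b} (xs : Vec Bool a) (ys : Vec Bool b) → wt (xs ++ ys) ≡ wt xs + wt ys
wt-++ []           ys = refl
wt-++ (true  ∷ xs) ys = cong suc (wt-++ xs ys)
wt-++ (false ∷ xs) ys = wt-++ xs ys

concatMap-inBall : ∀ {m₁ m₂ n₁ n₂} w₁ w₂
  (φ₁ : Vec Bool m₁ → Vec Bool n₁) (φ₂ : Vec Bool m₂ → Vec Bool n₂) →
  (∀ x → InBall w₁ (φ₁ x)) → (∀ x → InBall w₂ (φ₂ x)) →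
  ∀ x → InBall (w₁ + w₂) (concatMap φ₁ φ₂ x)
concatMap-inBall {m₁} w₁ w₂ φ₁ φ₂ ball₁ ball₂ x
  rewrite wt-++ (φ₁ (take m₁ x)) (φ₂ (drop m₁ x)) =
  +-mono-≤ (ball₁ (take m₁ x)) (ball₂ (drop m₁ x))

concatMap-injective : ∀ {m₁ m₂ n₁ n₂}
  (φ₁ : Vec Bool m₁ → Vec Bool n₁) (φ₂ : Vec Bool m₂ → Vec Bool n₂) →
  Injective _≡_ _≡_ φ₁ → Injective _≡_ _≡_ φ₂ →
  Injective _≡_ _≡_ (concatMap φ₁ φ₂)
concatMap-injective {m₁} φ₁ φ₂ inj₁' inj₂' {x} {y} eq
  with ++-injective (φ₁ (take m₁ x)) (φ₁ (take m₁ y)) eq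
... | eq₁ , eq₂ = begin
  x                      ≡⟨ take++drop≡id m₁ x ⟨
  take m₁ x ++ drop m₁ x ≡⟨ cong₂ _++_ (inj₁' eq₁) (inj₂' eq₂) ⟩
  take m₁ y ++ drop m₁ y ≡⟨ take++drop≡id m₁ y ⟩
  y                      ∎
  where open ≡-Reasoning

module _ {m₁ m₂ n₁ n₂ : ℕ} (G₁ : DominationGraph m₁ n₁) (G₂ : DominationGraph m₂ n₂) where
  open DominationGraph

  BlockEdge : Fin m₁ ⊎ Fin m₂ → Fin n₁ ⊎ Fin n₂ → Set
  BlockEdge (inj₁ i) (inj₁ j) = Edge G₁ i j
  BlockEdge (inj₁ _) (inj₂ _) = ⊥
  BlockEdge (inj₂ _) (inj₁ _) = ⊥
  BlockEdge (inj₂ i) (inj₂ j) = Edge G₂ i j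

  block-noIsolatedRight : (j : Fin n₁ ⊎ Fin n₂) →
    ∃[ i ] BlockEdge (splitAt m₁ i) j
  block-noIsolatedRight (inj₁ j) with noIsolatedRight G₁ j
  ... | i , e = i ↑ˡ m₂ , subst (λ s → BlockEdge s (inj₁ j)) (sym (splitAt-↑ˡ m₁ i m₂)) e
  block-noIsolatedRight (inj₂ j) with noIsolatedRight G₂ j
  ... | i , e = m₁ ↑ʳ i , subst (λ s → BlockEdge s (inj₂ j)) (sym (splitAt-↑ʳ m₁ m₂ i)) e

  _⊕_ : DominationGraph (m₁ + m₂) (n₁ + n₂)
  _⊕_ = record
    { Edge            = λ i j → BlockEdge (splitAt m₁ i) (splitAt n₁ j)
    ; noIsolatedRight = λ j → block-noIsolatedRight (splitAt n₁ j)
    }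

lookup-take-drop : ∀ {A : Set} m {n} (x : Vec A (m + n)) (i : Fin (m + n)) →
  [ lookup (take m x) , lookup (drop m x) ]′ (splitAt m i) ≡ lookup x i
lookup-take-drop m x i = begin
  [ lookup (take m x) , lookup (drop m x) ]′ (splitAt m i) ≡⟨ lookup-splitAt m (take m x) (drop m x) i ⟨
  lookup (take m x ++ drop m x) i                         ≡⟨ cong (λ v → lookup v i) (take++drop≡id m x) ⟩
  lookup x i                                              ∎
  where open ≡-Reasoning

concatMap-dominating : ∀ {m₁ m₂ n₁ n₂}
  {G₁ : DominationGraph m₁ n₁} {G₂ : DominationGraph m₂ n₂}
  (φ₁ : Vec Bool m₁ → Vec Bool n₁) (φ₂ : Vec Bool m₂ → Vec Bool n₂) →
  IsDominating G₁ φ₁ → IsDominating G₂ φ₂ →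
  IsDominating (G₁ ⊕ G₂) (concatMap φ₁ φ₂)
concatMap-dominating {m₁} {n₁ = n₁} {G₁ = G₁} {G₂ = G₂} φ₁ φ₂ dom₁ dom₂ x i j e xᵢ≡0 =
  trans (lookup-splitAt n₁ (φ₁ (take m₁ x)) (φ₂ (drop m₁ x)) j)
        (blockwise (splitAt m₁ i) (splitAt n₁ j) e
          (trans (lookup-take-drop m₁ x i) xᵢ≡0))
  where
  blockwise : ∀ si sj → BlockEdge G₁ G₂ si sj →
    [ lookup (take m₁ x) , lookup (drop m₁ x) ]′ si ≡ false →
    [ lookup (φ₁ (take m₁ x)) , lookup (φ₂ (drop m₁ x)) ]′ sj ≡ false
  blockwise (inj₁ a) (inj₁ b) e = dom₁ (take m₁ x) a b e
  blockwise (inj₂ a) (inj₂ b) e = dom₂ (drop m₁ x) a b e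
  blockwise (inj₁ _) (inj₂ _) ()
  blockwise (inj₂ _) (inj₁ _) ()

theorem9 : (m₁ n₁ w₁ m₂ n₂ w₂ : ℕ)
    (φ₁ : Vec Bool m₁ → Vec Bool n₁) (φ₂ : Vec Bool m₂ → Vec Bool n₂) →
    IsDominationMapping m₁ n₁ w₁ φ₁ →
    IsDominationMapping m₂ n₂ w₂ φ₂ →
    IsDominationMapping (m₁ + m₂) (n₁ + n₂) (w₁ + w₂) (concatMap φ₁ φ₂)
theorem9 m₁ n₁ w₁ m₂ n₂ w₂ φ₁ φ₂ (ball₁ , inj₁' , G₁ , dom₁) (ball₂ , inj₂' , G₂ , dom₂) =
    concatMap-inBall w₁ w₂ φ₁ φ₂ ball₁ ball₂
  , concatMap-injective φ₁ φ₂ inj₁' inj₂'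
  , G₁ ⊕ G₂
  , concatMap-dominating φ₁ φ₂ dom₁ dom₂
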